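{- Let $M, M'$ be terms. (1) If $M\to_h^* M'$, then there is a standard head sequence $(M,\dots,M')$ (i.e. one starting at $M$ and ending at $M'$). (2) If $M\to_{int}^* M'$, then there is a standard inner sequence $(M,\dots,M')$. (3) If $M\to_{\mathsf v}^* M'$, then there is a standard sequence $(M,\dots,M')$.
   Context: Terms and values of the call-by-value $\lambda$-calculus are defined by mutual induction from a countably infinite set of variables: values $V,U ::= x \mid \lambda x.M$ and terms $M,N,L ::= V \mid MN$. Terms are taken up to $\alpha$-conversion, application associates to the left, $\mathrm{fv}(M)$ is the set of free variables, and $M\{V/x\}$ is capture-avoiding substitution of the value $V$ for $x$. Every term can be written uniquely as $V N_1\dots N_n$ with $V$ a value and $n\ge0$. Root rules: $(\lambda x.M)V \mapsto_{\beta_v} M\{V/x\}$ ($V$ a value); $(\lambda x.M)NL \mapsto_{\sigma_1} (\lambda x.ML)N$ if $x\notin\mathrm{fv}(L)$; $V((\lambda x.L)N) \mapsto_{\sigma_3} (\lambda x.VL)N$ ($V$ a value, $x\notin\mathrm{fv}(V)$). $\mapsto_\sigma=\mapsto_{\sigma_1}\cup\mapsto_{\sigma_3}$, $\mapsto_{\mathsf v}=\mapsto_{\beta_v}\cup\mapsto_\sigma$; $\to_r$ is the closure of $\mapsto_r$ under one-hole contexts $C ::= [\cdot]\mid \lambda x.C\mid CM\mid MC$. $R^*$ is the reflexive-transitive closure of $R$. Head $\beta_v$-reduction $\to_{h\beta_v}$ is the least relation with: $(\lambda x.M)V M_1\dots M_m \to_{h\beta_v} M\{V/x\}M_1\dots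 M_m$ ($V$ value, $m\ge0$); if $N\to_{h\beta_v}N'$ then $VNM_1\dots M_m\to_{h\beta_v}VN'M_1\dots M_m$ ($V$ value). Head $\sigma$-reduction $\to_{h\sigma}$ is the least relation with: $(\lambda x.M)NLM_1\dots M_m\to_{h\sigma}(\lambda x.ML)NM_1\dots M_m$ ($x\notin\mathrm{fv}(L)$); $V((\lambda x.L)N)M_1\dots M_m\to_{h\sigma}(\lambda x.VL)NM_1\dots M_m$ ($V$ value, $x\notin\mathrm{fv}(V)$); if $N\to_{h\sigma}N'$ then $VNM_1\dots M_m\to_{h\sigma}VN'M_1\dots M_m$ ($V$ value). $\to_h=\to_{h\beta_v}\cup\to_{h\sigma}$ and $\to_{int}=\to_{\mathsf v}\setminus\to_h$. A standard head sequence is a finite sequence $(M_0,\dots,M_k,\dots,M_m)$ of terms, $0\le k\le m$, with $M_i\to_{h\beta_v}M_{i+1}$ for $0\le i<k$ and $M_i\to_{h\sigma}M_{i+1}$ for $k\le i<m$. Standard sequences and standard inner sequences are defined by simultaneous induction: (i) if $(M_0,\dots,M_m)$ is a standard head sequence and $(M_m,\dots,M_{m+n})$ is a standard inner sequence, then $(M_0,\dots,M_m,\dots,M_{m+n})$ is a standard sequence; (ii) $(M)$ is a standard inner sequence for every term $M$; (iii) if $(M_0,\dots,M_m)$ is a standard sequence then $(\lambda z.M_0,\dots,\lambda z.M_m)$ is a standard inner sequence; (iv) if $(V_0,\dots,V_h)$ is a standard sequence of values and $(M_0,\dots,M_m)$ is a standard inner sequence, then $(V_0M_0,\dots,V_hM_0,\dots,V_hM_m)$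 is a standard inner sequence; (v) if $(M_0,\dots,M_m)$ is a standard inner sequence with $M_0$ not a value and $(L_0,\dots,L_l)$ is a standard sequence, then $(M_0L_0,\dots,M_mL_0,\dots,M_mL_l)$ is a standard inner sequence. -}

module Defs where

-- Call-by-value λ-calculus with terms up to α-conversion, represented
-- with de Bruijn indices (unscoped: variables are natural numbers).

open import Data.Nat using (ℕ; zero; suc)
open import Data.List using (List; []; _∷_)
import Data.List as List
open import Data.List.NonEmpty using (List⁺; _∷_; _⁺++_; head; tail; last)
import Data.List.NonEmpty as List⁺
open import Data.List.Relation.Unary.All using (All)
open import Relation.Binary.PropositionalEquality using (_≡_)
open import Relation.Nullary using (¬_)
open import Data.Product using (_×_)

infixl 7 _·_
infixl 6 _·*_
infix 4 _↦βv_ _↦σ_ _↦v_ _→v_ _→hβv_ _→hσ_ _→h_ _→int_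

data Term : Set where
  var : ℕ → Term
  ƛ   : Term → Term
  _·_ : Term → Term → Term

data IsValue : Term → Set where
  v-var : ∀ {n} → IsValue (var n)
  v-lam : ∀ {M} → IsValue (ƛ M)

ext : (ℕ → ℕ) → ℕ → ℕ
ext ρ zero    = zero
ext ρ (suc n) = suc (ρ n)

rename : (ℕ → ℕ) → Term → Term
rename ρ (var n) = var (ρ n)
rename ρ (ƛ M)   = ƛ (rename (ext ρ) M)
rename ρ (M · N) = rename ρ M · rename ρ N

-- weakening: the term under one more binder (the new bound variable
-- does not occur free in it)
shift : Term → Term
shift = rename suc

exts : (ℕ → Term) → ℕ → Term
exts σ zero    = var zero
exts σ (suc n) = shift (σ n)

subst : (ℕ → Term) → Term → Term
subst σ (var n) = σ n
subst σ (ƛ M)   = ƛ (subst (exts σ) M)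
subst σ (M · N) = subst σ M · subst σ N

-- M{V/x} where x is the variable bound by the enclosing λ (index 0)
subst-zero : Term → ℕ → Term
subst-zero V zero    = V
subst-zero V (suc n) = var n

_[_] : Term → Term → Term
M [ V ] = subst (subst-zero V) M

_·*_ : Term → List Term → Term
M ·* []       = M
M ·* (N ∷ Ns) = (M · N) ·* Ns

data _↦βv_ : Term → Term → Set where
  βv : ∀ {M V} → IsValue V → (ƛ M · V) ↦βv (M [ V ])

-- σ₁: (λx.M)NL ↦ (λx.ML)N,  x ∉ fv(L)  (L is weakened under the binder)
-- σ₃: V((λx.L)N) ↦ (λx.VL)N, x ∉ fv(V)
data _↦σ_ : Term → Term → Set where
  σ₁ : ∀ {M N L} → (ƛ M · N · L) ↦σ (ƛ (M · shift L) · N)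
  σ₃ : ∀ {V L N} → IsValue V → (V · (ƛ L · N)) ↦σ (ƛ (shift V · L) · N)

data _↦v_ : Term → Term → Set where
  root-β : ∀ {M N} → M ↦βv N → M ↦v N
  root-σ : ∀ {M N} → M ↦σ N → M ↦v N

data _→v_ : Term → Term → Set where
  hole : ∀ {M N} → M ↦v N → M →v N
  lamC : ∀ {M N} → M →v N → ƛ M →v ƛ N
  appL : ∀ {M N L} → M →v N → (M · L) →v (N · L)
  appR : ∀ {M N L} → M →v N → (L · M) →v (L · N)

data _→hβv_ : Term → Term → Set where
  hβ-root : ∀ {M V} (Ms : List Term) → IsValue V →
            (ƛ M · V) ·* Ms →hβv (M [ V ]) ·* Ms
  hβ-arg  : ∀ {V N N'} (Ms : List Term) → IsValue V → N →hβv N' →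
            (V · N) ·* Ms →hβv (V · N') ·* Ms

data _→hσ_ : Term → Term → Set where
  hσ₁    : ∀ {M N L} (Ms : List Term) →
           (ƛ M · N · L) ·* Ms →hσ (ƛ (M · shift L) · N) ·* Ms
  hσ₃    : ∀ {V L N} (Ms : List Term) → IsValue V →
           (V · (ƛ L · N)) ·* Ms →hσ (ƛ (shift V · L) · N) ·* Ms
  hσ-arg : ∀ {V N N'} (Ms : List Term) → IsValue V → N →hσ N' →
           (V · N) ·* Ms →hσ (V · N') ·* Ms

data _→h_ : Term → Term → Set where
  h-β : ∀ {M N} → M →hβv N → M →h N
  h-σ : ∀ {M N} → M →hσ N → M →h N

_→int_ : Term → Term → Set
M →int N = (M →v N) × ¬ (M →h N)

-- Sequences of terms are non-empty lists (M₀ , … , Mₘ).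

data HeadSeqσ : List⁺ Term → Set where
  hσ-end  : ∀ M → HeadSeqσ (M ∷ [])
  hσ-step : ∀ {M} {s : List⁺ Term} → M →hσ head s → HeadSeqσ s →
            HeadSeqσ (M ∷ List⁺.toList s)

data StdHeadSeq : List⁺ Term → Set where
  hβ-done : ∀ {s} → HeadSeqσ s → StdHeadSeq s
  hβ-step : ∀ {M} {s : List⁺ Term} → M →hβv head s → StdHeadSeq s →
            StdHeadSeq (M ∷ List⁺.toList s)

mutual
  data StdSeq : List⁺ Term → Set where
    std : ∀ {s t} → StdHeadSeq s → StdInnerSeq t → last s ≡ head t →
          StdSeq (s ⁺++ tail t)

  data StdInnerSeq : List⁺ Term → Set where
    inner-refl : ∀ M → StdInnerSeq (M ∷ [])
    inner-lam  : ∀ {s} → StdSeq s → StdInnerSeq (List⁺.map ƛ s)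
    inner-valL : ∀ {vs ms} → StdSeq vs → All IsValue (List⁺.toList vs) →
                 StdInnerSeq ms →
                 StdInnerSeq (List⁺.map (_· head ms) vs
                                ⁺++ tail (List⁺.map (last vs ·_) ms))
    inner-app  : ∀ {ms ls} → StdInnerSeq ms → ¬ IsValue (head ms) →
                 StdSeq ls →
                 StdInnerSeq (List⁺.map (_· head ls) ms
                                ⁺++ tail (List⁺.map (last ms ·_) ls))

module Submission where

-- Following Takahashi/Plotkin, standard sequences are captured by an
-- inductive "standard reduction" relation: M ⇒s N holds when M reaches
-- some M' by head steps and M' ⇒i N is an inner standard reduction, which
-- descends into the immediate subterms (abstraction body, function and
-- argument) with standard reductions there.

open import Defs
open import Data.List.NonEmpty using (List⁺; head; last)
open import Data.Product using (_×_; Σ-syntax)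
open import Relation.Binary.PropositionalEquality using (_≡_)
open import Relation.Binary.Construct.Closure.ReflexiveTransitive using (Star)

open import Data.Nat using (ℕ; zero; suc)
open import Data.List using (List; []; _∷_; _++_)
import Data.List as List
open import Data.List.NonEmpty using (_∷_; _⁺++_; tail; toList)
import Data.List.NonEmpty as List⁺
open import Data.List.Relation.Unary.All using (All; []; _∷_; universal)
open import Data.List.Relation.Unary.All.Properties using (map⁺)
open import Data.Product using (_,_)
open import Data.Empty using (⊥-elim)
open import Relation.Nullary using (¬_; Dec; yes; no)
open import Function using (_∘_)
open import Relation.Binary.PropositionalEquality
  using (refl; sym; trans; cong; cong₂; subst₂; module ≡-Reasoning)
  renaming (subst to transport)
open import Relation.Binary.Construct.Closure.ReflexiveTransitive
  using (ε; _◅_; _◅◅_; gmap)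
import Relation.Binary.Construct.Closure.ReflexiveTransitive as Star
open import Relation.Binary.Construct.Closure.Reflexive using (ReflClosure)
  renaming (refl to no-step; [_] to one-step)

Seq : (List⁺ Term → Set) → Term → Term → Set
Seq P M M' = Σ[ s ∈ List⁺ Term ] (P s × head s ≡ M × last s ≡ M')

-- The last element of a non-empty list, computed by structural recursion;
-- the library's 'last' goes through a snoc-view and is hard to reason about.
lastFrom : ∀ {A : Set} → A → List A → A
lastFrom x []       = x
lastFrom x (y ∷ ys) = lastFrom y ys

lastFrom-∷ʳ : ∀ {A : Set} (x : A) ys y → lastFrom x (ys ++ y ∷ []) ≡ y
lastFrom-∷ʳ x []       y = refl
lastFrom-∷ʳ x (z ∷ ys) y = lastFrom-∷ʳ z ys y

last≡lastFrom : ∀ {A : Set} (x : A) xs → last (x ∷ xs) ≡ lastFrom x xs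
last≡lastFrom x xs with List.initLast xs
... | List.[]        = refl
... | ys List.∷ʳ′ y = sym (lastFrom-∷ʳ x ys y)

last-∷ : ∀ {A : Set} (x : A) (s : List⁺ A) → last (x ∷ toList s) ≡ last s
last-∷ x (y ∷ ys) = trans (last≡lastFrom x (y ∷ ys)) (sym (last≡lastFrom y ys))

last-map : ∀ {A B : Set} (f : A → B) (s : List⁺ A) → last (List⁺.map f s) ≡ f (last s)
last-map f (x ∷ xs) = begin
  last (f x ∷ List.map f xs)   ≡⟨ last≡lastFrom (f x) (List.map f xs) ⟩
  lastFrom (f x) (List.map f xs) ≡⟨ lastFrom-map x xs ⟩
  f (lastFrom x xs)             ≡⟨ cong f (sym (last≡lastFrom x xs)) ⟩
  f (last (x ∷ xs))             ∎
  where
  open ≡-Reasoning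
  lastFrom-map : ∀ y ys → lastFrom (f y) (List.map f ys) ≡ f (lastFrom y ys)
  lastFrom-map y []       = refl
  lastFrom-map y (z ∷ zs) = lastFrom-map z zs

last-⁺++ : ∀ {A : Set} (s t : List⁺ A) → last s ≡ head t → last (s ⁺++ tail t) ≡ last t
last-⁺++ (x ∷ xs) (y ∷ ys) meet = begin
  last (x ∷ xs ++ ys)     ≡⟨ last≡lastFrom x (xs ++ ys) ⟩
  lastFrom x (xs ++ ys)   ≡⟨ lastFrom-++ x xs ys (trans (sym (last≡lastFrom x xs)) meet) ⟩
  lastFrom y ys           ≡⟨ sym (last≡lastFrom y ys) ⟩
  last (y ∷ ys)           ∎
  where
  open ≡-Reasoning
  lastFrom-++ : ∀ z zs us → lastFrom z zs ≡ y → lastFrom z (zs ++ us) ≡ lastFrom y us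
  lastFrom-++ z []        us refl = refl
  lastFrom-++ z (w ∷ zs)  us e    = lastFrom-++ w zs us e

Ren : Set
Ren = ℕ → ℕ

Sub : Set
Sub = ℕ → Term

ext-cong : ∀ {ρ ρ' : Ren} → (∀ n → ρ n ≡ ρ' n) → ∀ n → ext ρ n ≡ ext ρ' n
ext-cong e zero    = refl
ext-cong e (suc n) = cong suc (e n)

rename-cong : ∀ {ρ ρ' : Ren} → (∀ n → ρ n ≡ ρ' n) → ∀ M → rename ρ M ≡ rename ρ' M
rename-cong e (var n) = cong var (e n)
rename-cong e (ƛ M)   = cong ƛ (rename-cong (ext-cong e) M)
rename-cong e (M · N) = cong₂ _·_ (rename-cong e M) (rename-cong e N)

exts-cong : ∀ {σ σ' : Sub} → (∀ n → σ n ≡ σ' n) → ∀ n → exts σ n ≡ exts σ' n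
exts-cong e zero    = refl
exts-cong e (suc n) = cong shift (e n)

subst-cong : ∀ {σ σ' : Sub} → (∀ n → σ n ≡ σ' n) → ∀ M → subst σ M ≡ subst σ' M
subst-cong e (var n) = e n
subst-cong e (ƛ M)   = cong ƛ (subst-cong (exts-cong e) M)
subst-cong e (M · N) = cong₂ _·_ (subst-cong e M) (subst-cong e N)

rename-rename : ∀ (ρ ρ' : Ren) M → rename ρ (rename ρ' M) ≡ rename (ρ ∘ ρ') M
rename-rename ρ ρ' (var n) = refl
rename-rename ρ ρ' (ƛ M)   =
  cong ƛ (trans (rename-rename (ext ρ) (ext ρ') M) (rename-cong (λ { zero → refl ; (suc n) → refl }) M))
rename-rename ρ ρ' (M · N) = cong₂ _·_ (rename-rename ρ ρ' M) (rename-rename ρ ρ' N)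

subst-rename : ∀ (σ : Sub) (ρ : Ren) M → subst σ (rename ρ M) ≡ subst (σ ∘ ρ) M
subst-rename σ ρ (var n) = refl
subst-rename σ ρ (ƛ M)   =
  cong ƛ (trans (subst-rename (exts σ) (ext ρ) M) (subst-cong (λ { zero → refl ; (suc n) → refl }) M))
subst-rename σ ρ (M · N) = cong₂ _·_ (subst-rename σ ρ M) (subst-rename σ ρ N)

rename-subst : ∀ (ρ : Ren) (σ : Sub) M → rename ρ (subst σ M) ≡ subst (rename ρ ∘ σ) M
rename-subst ρ σ (var n) = refl
rename-subst ρ σ (ƛ M)   = cong ƛ (trans (rename-subst (ext ρ) (exts σ) M) (subst-cong under-binder M))
  where
  under-binder : ∀ n → rename (ext ρ) (exts σ n) ≡ exts (rename ρ ∘ σ) n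
  under-binder zero    = refl
  under-binder (suc n) = trans (rename-rename (ext ρ) suc (σ n)) (sym (rename-rename suc ρ (σ n)))
rename-subst ρ σ (M · N) = cong₂ _·_ (rename-subst ρ σ M) (rename-subst ρ σ N)

subst-subst : ∀ (τ σ : Sub) M → subst τ (subst σ M) ≡ subst (subst τ ∘ σ) M
subst-subst τ σ (var n) = refl
subst-subst τ σ (ƛ M)   = cong ƛ (trans (subst-subst (exts τ) (exts σ) M) (subst-cong under-binder M))
  where
  under-binder : ∀ n → subst (exts τ) (exts σ n) ≡ exts (subst τ ∘ σ) n
  under-binder zero    = refl
  under-binder (suc n) = trans (subst-rename (exts τ) suc (σ n)) (sym (rename-subst suc τ (σ n)))
subst-subst τ σ (M · N) = cong₂ _·_ (subst-subst τ σ M) (subst-subst τ σ N)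

subst-var : ∀ M → subst var M ≡ M
subst-var (var n) = refl
subst-var (ƛ M)   = cong ƛ (trans (subst-cong (λ { zero → refl ; (suc n) → refl }) M) (subst-var M))
subst-var (M · N) = cong₂ _·_ (subst-var M) (subst-var N)

rename-as-subst : ∀ (ρ : Ren) M → rename ρ M ≡ subst (var ∘ ρ) M
rename-as-subst ρ (var n) = refl
rename-as-subst ρ (ƛ M)   =
  cong ƛ (trans (rename-as-subst (ext ρ) M) (subst-cong (λ { zero → refl ; (suc n) → refl }) M))
rename-as-subst ρ (M · N) = cong₂ _·_ (rename-as-subst ρ M) (rename-as-subst ρ N)

subst-shift : ∀ (σ : Sub) L → subst (exts σ) (shift L) ≡ shift (subst σ L)
subst-shift σ L = trans (subst-rename (exts σ) suc L) (sym (rename-subst suc σ L))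

shift-[] : ∀ N L → (shift L) [ N ] ≡ L
shift-[] N L = trans (subst-rename (subst-zero N) suc L) (subst-var L)

subst-[] : ∀ (σ : Sub) M V → subst σ (M [ V ]) ≡ (subst (exts σ) M) [ subst σ V ]
subst-[] σ M V =
  trans (subst-subst σ (subst-zero V) M)
        (trans (subst-cong pointwise M) (sym (subst-subst (subst-zero (subst σ V)) (exts σ) M)))
  where
  pointwise : ∀ n → subst σ (subst-zero V n) ≡ subst (subst-zero (subst σ V)) (exts σ n)
  pointwise zero    = refl
  pointwise (suc n) = sym (shift-[] (subst σ V) (σ n))

-- This is equivalent to the M N₁ … Nₙ spine presentation of Defs, but
-- easier to induct on.

infix 4 _↝β_ _↝σ_ _↝_

data _↝β_ : Term → Term → Set where
  ↝β-root : ∀ {M V} → IsValue V → ƛ M · V ↝β M [ V ]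
  ↝β-arg  : ∀ {V N N'} → IsValue V → N ↝β N' → V · N ↝β V · N'
  ↝β-fun  : ∀ {M M' L} → M ↝β M' → M · L ↝β M' · L

data _↝σ_ : Term → Term → Set where
  ↝σ₁    : ∀ {M N L} → ƛ M · N · L ↝σ ƛ (M · shift L) · N
  ↝σ₃    : ∀ {V L N} → IsValue V → V · (ƛ L · N) ↝σ ƛ (shift V · L) · N
  ↝σ-arg : ∀ {V N N'} → IsValue V → N ↝σ N' → V · N ↝σ V · N'
  ↝σ-fun : ∀ {M M' L} → M ↝σ M' → M · L ↝σ M' · L

data _↝_ : Term → Term → Set where
  β-step : ∀ {M N} → M ↝β N → M ↝ N
  σ-step : ∀ {M N} → M ↝σ N → M ↝ N

·*-∷ʳ : ∀ M Ms L → (M ·* Ms) · L ≡ M ·* (Ms ++ L ∷ [])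
·*-∷ʳ M []       L = refl
·*-∷ʳ M (N ∷ Ms) L = ·*-∷ʳ (M · N) Ms L

↝β-spine : ∀ {A B} → A ↝β B → ∀ Ms → A ·* Ms ↝β B ·* Ms
↝β-spine h []       = h
↝β-spine h (N ∷ Ms) = ↝β-spine (↝β-fun h) Ms

↝σ-spine : ∀ {A B} → A ↝σ B → ∀ Ms → A ·* Ms ↝σ B ·* Ms
↝σ-spine h []       = h
↝σ-spine h (N ∷ Ms) = ↝σ-spine (↝σ-fun h) Ms

→hβv⇒↝β : ∀ {M N} → M →hβv N → M ↝β N
→hβv⇒↝β (hβ-root Ms v)  = ↝β-spine (↝β-root v) Ms
→hβv⇒↝β (hβ-arg Ms v h) = ↝β-spine (↝β-arg v (→hβv⇒↝β h)) Ms

→hσ⇒↝σ : ∀ {M N} → M →hσ N → M ↝σ N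
→hσ⇒↝σ (hσ₁ Ms)        = ↝σ-spine ↝σ₁ Ms
→hσ⇒↝σ (hσ₃ Ms v)      = ↝σ-spine (↝σ₃ v) Ms
→hσ⇒↝σ (hσ-arg Ms v h) = ↝σ-spine (↝σ-arg v (→hσ⇒↝σ h)) Ms

→h⇒↝ : ∀ {M N} → M →h N → M ↝ N
→h⇒↝ (h-β h) = β-step (→hβv⇒↝β h)
→h⇒↝ (h-σ h) = σ-step (→hσ⇒↝σ h)

→hβv-fun : ∀ {M M' L} → M →hβv M' → M · L →hβv M' · L
→hβv-fun {L = L} (hβ-root Ms v) =
  subst₂ _→hβv_ (sym (·*-∷ʳ _ Ms L)) (sym (·*-∷ʳ _ Ms L)) (hβ-root (Ms ++ L ∷ []) v)
→hβv-fun {L = L} (hβ-arg Ms v h) =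
  subst₂ _→hβv_ (sym (·*-∷ʳ _ Ms L)) (sym (·*-∷ʳ _ Ms L)) (hβ-arg (Ms ++ L ∷ []) v h)

→hσ-fun : ∀ {M M' L} → M →hσ M' → M · L →hσ M' · L
→hσ-fun {L = L} (hσ₁ Ms) =
  subst₂ _→hσ_ (sym (·*-∷ʳ _ Ms L)) (sym (·*-∷ʳ _ Ms L)) (hσ₁ (Ms ++ L ∷ []))
→hσ-fun {L = L} (hσ₃ Ms v) =
  subst₂ _→hσ_ (sym (·*-∷ʳ _ Ms L)) (sym (·*-∷ʳ _ Ms L)) (hσ₃ (Ms ++ L ∷ []) v)
→hσ-fun {L = L} (hσ-arg Ms v h) =
  subst₂ _→hσ_ (sym (·*-∷ʳ _ Ms L)) (sym (·*-∷ʳ _ Ms L)) (hσ-arg (Ms ++ L ∷ []) v h)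

↝β⇒→hβv : ∀ {M N} → M ↝β N → M →hβv N
↝β⇒→hβv (↝β-root v)  = hβ-root [] v
↝β⇒→hβv (↝β-arg v h) = hβ-arg [] v (↝β⇒→hβv h)
↝β⇒→hβv (↝β-fun h)   = →hβv-fun (↝β⇒→hβv h)

↝σ⇒→hσ : ∀ {M N} → M ↝σ N → M →hσ N
↝σ⇒→hσ ↝σ₁          = hσ₁ []
↝σ⇒→hσ (↝σ₃ v)      = hσ₃ [] v
↝σ⇒→hσ (↝σ-arg v h) = hσ-arg [] v (↝σ⇒→hσ h)
↝σ⇒→hσ (↝σ-fun h)   = →hσ-fun (↝σ⇒→hσ h)

↝⇒→h : ∀ {M N} → M ↝ N → M →h N
↝⇒→h (β-step h) = h-β (↝β⇒→hβv h)
↝⇒→h (σ-step h) = h-σ (↝σ⇒→hσ h)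

↝-fun : ∀ {M M' L} → M ↝ M' → M · L ↝ M' · L
↝-fun (β-step h) = β-step (↝β-fun h)
↝-fun (σ-step h) = σ-step (↝σ-fun h)

↝-arg : ∀ {V N N'} → IsValue V → N ↝ N' → V · N ↝ V · N'
↝-arg v (β-step h) = β-step (↝β-arg v h)
↝-arg v (σ-step h) = σ-step (↝σ-arg v h)

value-↝-free : ∀ {V N} → IsValue V → ¬ V ↝ N
value-↝-free v-var (β-step ())
value-↝-free v-var (σ-step ())
value-↝-free v-lam (β-step ())
value-↝-free v-lam (σ-step ())

↝σ-non-value : ∀ {M N} → M ↝σ N → ¬ IsValue N
↝σ-non-value ↝σ₁         ()
↝σ-non-value (↝σ₃ _)     ()
↝σ-non-value (↝σ-arg _ _) ()
↝σ-non-value (↝σ-fun _)  ()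

isValue? : ∀ M → Dec (IsValue M)
isValue? (var n) = yes v-var
isValue? (ƛ M)   = yes v-lam
isValue? (M · N) = no (λ ())

-- Head reduction is stable under substitutions of values (and hence under
-- renamings): the redexes stay redexes since values are mapped to values.

ValueSub : Sub → Set
ValueSub σ = ∀ n → IsValue (σ n)

subst-value : ∀ {σ V} → ValueSub σ → IsValue V → IsValue (subst σ V)
subst-value {σ} {var n} vs v-var = vs n
subst-value vs v-lam = v-lam

rename-value : ∀ {ρ V} → IsValue V → IsValue (rename ρ V)
rename-value v-var = v-var
rename-value v-lam = v-lam

rename-non-value : ∀ {ρ M} → ¬ IsValue M → ¬ IsValue (rename ρ M)
rename-non-value {M = var n} nv _ = nv v-var
rename-non-value {M = ƛ M}   nv _ = nv v-lam
rename-non-value {M = M · N} nv ()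

exts-value : ∀ {σ} → ValueSub σ → ValueSub (exts σ)
exts-value vs zero    = v-var
exts-value vs (suc n) = rename-value (vs n)

subst-↝β : ∀ {σ M N} → ValueSub σ → M ↝β N → subst σ M ↝β subst σ N
subst-↝β {σ} vs (↝β-root {M} {V} v) = transport (_↝β_ _) (sym (subst-[] σ M V)) (↝β-root (subst-value vs v))
subst-↝β vs (↝β-arg v h) = ↝β-arg (subst-value vs v) (subst-↝β vs h)
subst-↝β vs (↝β-fun h)   = ↝β-fun (subst-↝β vs h)

subst-↝σ : ∀ {σ M N} → ValueSub σ → M ↝σ N → subst σ M ↝σ subst σ N
subst-↝σ {σ} vs (↝σ₁ {M} {N} {L}) =
  transport (_↝σ_ _) (cong (λ X → ƛ (subst (exts σ) M · X) · subst σ N) (sym (subst-shift σ L))) ↝σ₁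
subst-↝σ {σ} vs (↝σ₃ {V} {L} {N} v) =
  transport (_↝σ_ _) (cong (λ X → ƛ (X · subst (exts σ) L) · subst σ N) (sym (subst-shift σ V)))
            (↝σ₃ (subst-value vs v))
subst-↝σ vs (↝σ-arg v h) = ↝σ-arg (subst-value vs v) (subst-↝σ vs h)
subst-↝σ vs (↝σ-fun h)   = ↝σ-fun (subst-↝σ vs h)

subst-↝ : ∀ {σ M N} → ValueSub σ → M ↝ N → subst σ M ↝ subst σ N
subst-↝ vs (β-step h) = β-step (subst-↝β vs h)
subst-↝ vs (σ-step h) = σ-step (subst-↝σ vs h)

rename-↝ : ∀ (ρ : Ren) {M N} → M ↝ N → rename ρ M ↝ rename ρ N
rename-↝ ρ {M} {N} h =
  subst₂ _↝_ (sym (rename-as-subst ρ M)) (sym (rename-as-subst ρ N)) (subst-↝ (λ n → v-var) h)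

-- Standard reduction (the inductive counterpart of standard sequences).
-- M ⇒i N mirrors the clauses (ii)–(v) of standard inner sequences:
-- a variable, a body under λ, a value applied to an argument (both
-- reduced internally), or a non-value applied to a standard argument.

infix 4 _⇒s_ _⇒i_

mutual
  data _⇒s_ : Term → Term → Set where
    head-then : ∀ {M M' N} → Star _↝_ M M' → M' ⇒i N → M ⇒s N

  data _⇒i_ : Term → Term → Set where
    ⇒i-var : ∀ {n} → var n ⇒i var n
    ⇒i-lam : ∀ {M N} → M ⇒s N → ƛ M ⇒i ƛ N
    ⇒i-val : ∀ {V V' N N'} → IsValue V → V ⇒i V' → N ⇒i N' → V · N ⇒i V' · N'
    ⇒i-app : ∀ {M M' L L'} → ¬ IsValue M → M ⇒i M' → L ⇒s L' → M · L ⇒i M' · L'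

⇒i⇒⇒s : ∀ {M N} → M ⇒i N → M ⇒s N
⇒i⇒⇒s = head-then ε

↝*-⇒s : ∀ {M M₁ N} → Star _↝_ M M₁ → M₁ ⇒s N → M ⇒s N
↝*-⇒s hs (head-then hs' i) = head-then (hs ◅◅ hs') i

⇒i-value : ∀ {M N} → IsValue M → M ⇒i N → IsValue N
⇒i-value v-var ⇒i-var     = v-var
⇒i-value v-lam (⇒i-lam _) = v-lam

⇒i-value⁻¹ : ∀ {M N} → M ⇒i N → IsValue N → IsValue M
⇒i-value⁻¹ ⇒i-var     _ = v-var
⇒i-value⁻¹ (⇒i-lam _) _ = v-lam

⇒s-value : ∀ {V V'} → IsValue V → V ⇒s V' → V ⇒i V'
⇒s-value v (head-then ε i)       = i
⇒s-value v (head-then (h ◅ _) i) = ⊥-elim (value-↝-free v h)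

mutual
  ⇒i-refl : ∀ M → M ⇒i M
  ⇒i-refl (var n) = ⇒i-var
  ⇒i-refl (ƛ M)   = ⇒i-lam (⇒s-refl M)
  ⇒i-refl (M · N) with isValue? M
  ... | yes v = ⇒i-val v (⇒i-refl M) (⇒i-refl N)
  ... | no nv = ⇒i-app nv (⇒i-refl M) (⇒s-refl N)

  ⇒s-refl : ∀ M → M ⇒s M
  ⇒s-refl M = ⇒i⇒⇒s (⇒i-refl M)

-- Standard reduction is a congruence for application: reduce the function
-- in standard order; if it ends in a value, continue with the argument.
⇒s-app : ∀ {M M' N N'} → M ⇒s M' → N ⇒s N' → M · N ⇒s M' · N'
⇒s-app {N = N} (head-then {M' = M₁} hm im) sn with isValue? M₁
... | no nv = head-then (gmap (_· N) ↝-fun hm) (⇒i-app nv im sn)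
⇒s-app {N = N} (head-then {M' = M₁} hm im) (head-then hn in') | yes v =
  head-then (gmap (_· N) ↝-fun hm ◅◅ gmap (M₁ ·_) (↝-arg v) hn) (⇒i-val v im in')

mutual
  rename-⇒s : ∀ (ρ : Ren) {M N} → M ⇒s N → rename ρ M ⇒s rename ρ N
  rename-⇒s ρ (head-then hs i) = head-then (gmap (rename ρ) (rename-↝ ρ) hs) (rename-⇒i ρ i)

  rename-⇒i : ∀ (ρ : Ren) {M N} → M ⇒i N → rename ρ M ⇒i rename ρ N
  rename-⇒i ρ ⇒i-var            = ⇒i-var
  rename-⇒i ρ (⇒i-lam a)        = ⇒i-lam (rename-⇒s (ext ρ) a)
  rename-⇒i ρ (⇒i-val v a b)    = ⇒i-val (rename-value v) (rename-⇒i ρ a) (rename-⇒i ρ b)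
  rename-⇒i ρ (⇒i-app nv a c)   = ⇒i-app (rename-non-value nv) (rename-⇒i ρ a) (rename-⇒s ρ c)

-- Inner reductions become general
-- standard reductions, since substituted values can create head redexes.
mutual
  subst-⇒s : ∀ {σ₀ σ} → ValueSub σ₀ → ValueSub σ → (∀ n → σ₀ n ⇒s σ n) →
             ∀ {M N} → M ⇒s N → subst σ₀ M ⇒s subst σ N
  subst-⇒s {σ₀} vs₀ vs r (head-then hs i) =
    ↝*-⇒s (gmap (subst σ₀) (subst-↝ vs₀) hs) (subst-⇒i vs₀ vs r i)

  subst-⇒i : ∀ {σ₀ σ} → ValueSub σ₀ → ValueSub σ → (∀ n → σ₀ n ⇒s σ n) →
             ∀ {M N} → M ⇒i N → subst σ₀ M ⇒s subst σ N
  subst-⇒i vs₀ vs r (⇒i-var {n})    = r n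
  subst-⇒i vs₀ vs r (⇒i-lam a)      =
    ⇒i⇒⇒s (⇒i-lam (subst-⇒s (exts-value vs₀) (exts-value vs) exts-related a))
    where
    exts-related : ∀ n → exts _ n ⇒s exts _ n
    exts-related zero    = ⇒s-refl (var zero)
    exts-related (suc n) = rename-⇒s suc (r n)
  subst-⇒i vs₀ vs r (⇒i-val v a b)  = ⇒s-app (subst-⇒i vs₀ vs r a) (subst-⇒i vs₀ vs r b)
  subst-⇒i vs₀ vs r (⇒i-app nv a c) = ⇒s-app (subst-⇒i vs₀ vs r a) (subst-⇒s vs₀ vs r c)

[]-⇒s : ∀ {V₀ V A₀ A} → IsValue V₀ → V₀ ⇒s V → A₀ ⇒s A → A₀ [ V₀ ] ⇒s A [ V ]
[]-⇒s {V₀} {V} v s a = subst-⇒s vs₀ vs related a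
  where
  vs₀ : ValueSub (subst-zero V₀)
  vs₀ zero    = v
  vs₀ (suc n) = v-var
  vs : ValueSub (subst-zero V)
  vs zero    = ⇒i-value v (⇒s-value v s)
  vs (suc n) = v-var
  related : ∀ n → subst-zero V₀ n ⇒s subst-zero V n
  related zero    = s
  related (suc n) = ⇒s-refl (var n)

-- A root step after an inner reduction M ⇒i N means N is a
-- redex; the redex was already present in M (values are reflected by ⇒i),
-- so it is contracted as a head step of M first and the inner reduction is
-- replayed on the contractum, by substitutivity for βv and directly for σ.
mutual
  absorbᵢ : ∀ {M N P} → M ⇒i N → N →v P → M ⇒s P
  absorbᵢ (⇒i-val v (⇒i-lam a) b) (hole (root-β (βv w))) =
    ↝*-⇒s (Star.return (β-step (↝β-root w₀))) ([]-⇒s w₀ (⇒i⇒⇒s b) a)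
    where w₀ = ⇒i-value⁻¹ b w
  absorbᵢ (⇒i-app nv (⇒i-lam _) _) (hole (root-β (βv _))) = ⊥-elim (nv v-lam)
  absorbᵢ (⇒i-val v a _) (hole (root-σ σ₁)) with ⇒i-value v a
  ... | ()
  absorbᵢ (⇒i-app _ (⇒i-val _ (⇒i-lam a) b) c) (hole (root-σ σ₁)) =
    ↝*-⇒s (Star.return (σ-step ↝σ₁))
          (⇒i⇒⇒s (⇒i-val v-lam (⇒i-lam (⇒s-app a (rename-⇒s suc c))) b))
  absorbᵢ (⇒i-app _ (⇒i-app nv (⇒i-lam _) _) _) (hole (root-σ σ₁)) = ⊥-elim (nv v-lam)
  absorbᵢ (⇒i-val v a (⇒i-val _ (⇒i-lam l) b)) (hole (root-σ (σ₃ _))) =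
    ↝*-⇒s (Star.return (σ-step (↝σ₃ v)))
          (⇒i⇒⇒s (⇒i-val v-lam (⇒i-lam (⇒s-app (rename-⇒s suc (⇒i⇒⇒s a)) l)) b))
  absorbᵢ (⇒i-val _ _ (⇒i-app nv (⇒i-lam _) _)) (hole (root-σ (σ₃ _))) = ⊥-elim (nv v-lam)
  absorbᵢ (⇒i-app nv a _) (hole (root-σ (σ₃ w))) = ⊥-elim (nv (⇒i-value⁻¹ a w))
  absorbᵢ (⇒i-lam a)      (lamC st) = ⇒i⇒⇒s (⇒i-lam (absorb a st))
  absorbᵢ (⇒i-val _ a b)  (appL st) = ⇒s-app (absorbᵢ a st) (⇒i⇒⇒s b)
  absorbᵢ (⇒i-app _ a c)  (appL st) = ⇒s-app (absorbᵢ a st) c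
  absorbᵢ (⇒i-val _ a b)  (appR st) = ⇒s-app (⇒i⇒⇒s a) (absorbᵢ b st)
  absorbᵢ (⇒i-app _ a c)  (appR st) = ⇒s-app (⇒i⇒⇒s a) (absorb c st)

  absorb : ∀ {M N P} → M ⇒s N → N →v P → M ⇒s P
  absorb (head-then hs i) st = ↝*-⇒s hs (absorbᵢ i st)

→v*⇒⇒s : ∀ {M P} → Star _→v_ M P → M ⇒s P
→v*⇒⇒s {M} = go (⇒s-refl M)
  where
  go : ∀ {N P} → M ⇒s N → Star _→v_ N P → M ⇒s P
  go s ε        = s
  go s (st ◅ r) = go (absorb s st) r

-- An internal step (one that is not a head step) preserves inner standard
-- reductions: it cannot be at the root, nor in a position where the
-- enclosing term would perform it as a head step.
⇒i-internal : ∀ {M N P} → M ⇒i N → N →v P → ¬ N →h P → M ⇒i P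
⇒i-internal i (hole (root-β (βv w)))  not-head = ⊥-elim (not-head (h-β (hβ-root [] w)))
⇒i-internal i (hole (root-σ σ₁))      not-head = ⊥-elim (not-head (h-σ (hσ₁ [])))
⇒i-internal i (hole (root-σ (σ₃ w)))  not-head = ⊥-elim (not-head (h-σ (hσ₃ [] w)))
⇒i-internal (⇒i-lam a) (lamC st) _ = ⇒i-lam (absorb a st)
⇒i-internal (⇒i-val v a b) (appL st) not-head =
  ⇒i-val v (⇒i-internal a st (not-head ∘ ↝⇒→h ∘ ↝-fun ∘ →h⇒↝)) b
⇒i-internal (⇒i-app nv a c) (appL st) not-head =
  ⇒i-app nv (⇒i-internal a st (not-head ∘ ↝⇒→h ∘ ↝-fun ∘ →h⇒↝)) c
⇒i-internal (⇒i-val v a b) (appR st) not-head =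
  ⇒i-val v a (⇒i-internal b st (not-head ∘ ↝⇒→h ∘ ↝-arg (⇒i-value v a) ∘ →h⇒↝))
⇒i-internal (⇒i-app nv a c) (appR st) _ = ⇒i-app nv a (absorb c st)

→int*⇒⇒i : ∀ {M P} → Star _→int_ M P → M ⇒i P
→int*⇒⇒i {M} = go (⇒i-refl M)
  where
  go : ∀ {N P} → M ⇒i N → Star _→int_ N P → M ⇒i P
  go i ε                      = i
  go i ((st , not-head) ◅ r) = go (⇒i-internal i st not-head) r

-- A σ-step followed by a βv-step can be
-- replaced by a βv-step followed by at most one σ-step: at the root the
-- σ-rearrangement is undone by the substitution, otherwise the β-redex
-- lies in the argument N, untouched by the σ-step.
σβ-swap : ∀ {M N P} → M ↝σ N → N ↝β P → Σ[ Q ∈ Term ] (M ↝β Q × ReflClosure _↝σ_ Q P)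
σβ-swap (↝σ₁ {M} {N} {L}) (↝β-root v) =
  _ , transport (ƛ M · N · L ↝β_) (cong (M [ N ] ·_) (sym (shift-[] N L))) (↝β-fun (↝β-root v)) , no-step
σβ-swap ↝σ₁ (↝β-arg _ h) = _ , ↝β-fun (↝β-arg v-lam h) , one-step ↝σ₁
σβ-swap ↝σ₁ (↝β-fun ())
σβ-swap (↝σ₃ {V} {L} {N} v) (↝β-root w) =
  _ , transport (V · (ƛ L · N) ↝β_) (cong (_· L [ N ]) (sym (shift-[] N V))) (↝β-arg v (↝β-root w)) , no-step
σβ-swap (↝σ₃ v) (↝β-arg _ h) = _ , ↝β-arg v (↝β-arg v-lam h) , one-step (↝σ₃ v)
σβ-swap (↝σ₃ v) (↝β-fun ())
σβ-swap (↝σ-arg v s) (↝β-root w) = ⊥-elim (↝σ-non-value s w)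
σβ-swap (↝σ-arg v s) (↝β-arg _ h) with σβ-swap s h
... | _ , b , no-step = _ , ↝β-arg v b , no-step
... | _ , b , one-step s'  = _ , ↝β-arg v b , one-step (↝σ-arg v s')
σβ-swap (↝σ-arg v s) (↝β-fun h) = ⊥-elim (value-↝-free v (β-step h))
σβ-swap (↝σ-fun s) (↝β-root _)  = ⊥-elim (↝σ-non-value s v-lam)
σβ-swap (↝σ-fun s) (↝β-arg w _) = ⊥-elim (↝σ-non-value s w)
σβ-swap (↝σ-fun s) (↝β-fun h) with σβ-swap s h
... | _ , b , no-step = _ , ↝β-fun b , no-step
... | _ , b , one-step s'  = _ , ↝β-fun b , one-step (↝σ-fun s')

σ-past-β* : ∀ {M M₁ M'} → M ↝σ M₁ → Star _↝β_ M₁ M' →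
            Σ[ M'' ∈ Term ] (Star _↝β_ M M'' × Star _↝σ_ M'' M')
σ-past-β* s ε = _ , ε , Star.return s
σ-past-β* s (b ◅ bs) with σβ-swap s b
... | _ , b' , no-step = _ , b' ◅ bs , ε
... | _ , b' , one-step s' with σ-past-β* s' bs
...   | _ , bs' , ss = _ , b' ◅ bs' , ss

postpone : ∀ {M N} → Star _↝_ M N → Σ[ M₁ ∈ Term ] (Star _↝β_ M M₁ × Star _↝σ_ M₁ N)
postpone ε = _ , ε , ε
postpone (β-step b ◅ r) with postpone r
... | _ , bs , ss = _ , b ◅ bs , ss
postpone (σ-step s ◅ r) with postpone r
... | _ , bs , ss with σ-past-β* s bs
...   | _ , bs' , ss' = _ , bs' , ss' ◅◅ ss

cons-Seq : ∀ {P Q : List⁺ Term → Set} {M N N'} →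
           (∀ {s} → N ≡ head s → P s → Q (M ∷ toList s)) → Seq P N N' → Seq Q M N'
cons-Seq extend (s , ps , refl , l) = _ , extend refl ps , refl , trans (last-∷ _ s) l

↝σ*-seq : ∀ {M N} → Star _↝σ_ M N → Seq HeadSeqσ M N
↝σ*-seq ε        = _ , hσ-end _ , refl , refl
↝σ*-seq (s ◅ ss) = cons-Seq (λ { refl → hσ-step (↝σ⇒→hσ s) }) (↝σ*-seq ss)

β*σ*-seq : ∀ {M M₁ N} → Star _↝β_ M M₁ → Star _↝σ_ M₁ N → Seq StdHeadSeq M N
β*σ*-seq ε ss with ↝σ*-seq ss
... | s , hs , h , l = s , hβ-done hs , h , l
β*σ*-seq (b ◅ bs) ss = cons-Seq (λ { refl → hβ-step (↝β⇒→hβv b) }) (β*σ*-seq bs ss)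

-- The application sequence of clauses (iv) and (v): the function runs
-- through s with the argument fixed, then the argument runs through t.
last-appSeq : (s t : List⁺ Term) →
  last (List⁺.map (_· head t) s ⁺++ tail (List⁺.map (last s ·_) t)) ≡ last s · last t
last-appSeq s t = begin
  last (List⁺.map (_· head t) s ⁺++ tail (List⁺.map (last s ·_) t))
    ≡⟨ last-⁺++ (List⁺.map (_· head t) s) (List⁺.map (last s ·_) t) (last-map (_· head t) s) ⟩
  last (List⁺.map (last s ·_) t)
    ≡⟨ last-map (last s ·_) t ⟩
  last s · last t ∎
  where open ≡-Reasoning

inner⇒std : ∀ {t} → StdInnerSeq t → StdSeq t
inner⇒std {t} it = std (hβ-done (hσ-end (head t))) it refl

mutual
  ⇒s-seq : ∀ {M N} → M ⇒s N → Seq StdSeq M N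
  ⇒s-seq (head-then hs i) with postpone hs
  ... | _ , bs , ss with β*σ*-seq bs ss | ⇒i-seq i
  ... | s , sh , h₁ , l₁ | t , ti , h₂ , l₂ =
    s ⁺++ tail t , std sh ti meet , h₁ , trans (last-⁺++ s t meet) l₂
    where meet = trans l₁ (sym h₂)

  ⇒i-seq : ∀ {M N} → M ⇒i N → Seq StdInnerSeq M N
  ⇒i-seq ⇒i-var = _ , inner-refl _ , refl , refl
  ⇒i-seq (⇒i-lam a) with ⇒s-seq a
  ... | s , ss , h , l = List⁺.map ƛ s , inner-lam ss , cong ƛ h , trans (last-map ƛ s) (cong ƛ l)
  ⇒i-seq (⇒i-val v a b) with value-seq v a | ⇒i-seq b
  ... | vs , svs , all-values , h₁ , l₁ | ms , sms , h₂ , l₂ =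
    _ , inner-valL svs all-values sms , cong₂ _·_ h₁ h₂ , trans (last-appSeq vs ms) (cong₂ _·_ l₁ l₂)
  ⇒i-seq (⇒i-app nv a c) with ⇒i-seq a | ⇒s-seq c
  ... | ms , sms , h₁ , l₁ | ls , sls , h₂ , l₂ =
    _ , inner-app sms (nv ∘ transport IsValue h₁) sls , cong₂ _·_ h₁ h₂ ,
    trans (last-appSeq ms ls) (cong₂ _·_ l₁ l₂)

  value-seq : ∀ {V V'} → IsValue V → V ⇒i V' →
              Σ[ s ∈ List⁺ Term ] (StdSeq s × All IsValue (toList s) × head s ≡ V × last s ≡ V')
  value-seq v-var ⇒i-var = _ , inner⇒std (inner-refl _) , v-var ∷ [] , refl , refl
  value-seq v-lam (⇒i-lam a) with ⇒s-seq a
  ... | s , ss , h , l =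
    List⁺.map ƛ s , inner⇒std (inner-lam ss) , map⁺ (universal (λ _ → v-lam) (toList s)) ,
    cong ƛ h , trans (last-map ƛ s) (cong ƛ l)

theorem4p6 : (M M' : Term) →
    (Star _→h_ M M' → Σ[ s ∈ List⁺ Term ] (StdHeadSeq s × head s ≡ M × last s ≡ M'))
    × (Star _→int_ M M' → Σ[ s ∈ List⁺ Term ] (StdInnerSeq s × head s ≡ M × last s ≡ M'))
    × (Star _→v_ M M' → Σ[ s ∈ List⁺ Term ] (StdSeq s × head s ≡ M × last s ≡ M'))
theorem4p6 M M' = head-part , (⇒i-seq ∘ →int*⇒⇒i) , (⇒s-seq ∘ →v*⇒⇒s)
  where
  head-part : Star _→h_ M M' → Seq StdHeadSeq M M'
  head-part r with postpone (Star.map →h⇒↝ r)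
  ... | _ , bs , ss = β*σ*-seq bs ss
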